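{- Let $\mathcal{G}$ be a simple temporal clique, and let $E^-_T$ and the emitters be as defined below. For every vertex $v$ that is not an emitter, there exist a vertex $v'\neq v$ lying in the same weakly connected component of the digraph $(V,E^-_T)$ as $v$ (which may or may not be an emitter) and a journey from $v$ to $v'$ consisting of at most two edges whose last edge is $e^-(v')$.
   Context: A simple temporal clique is a pair $\mathcal{G}=(G,\lambda)$ where $G=(V,E)$ is the complete graph on a finite vertex set $V$ with $|V|\ge 2$, and $\lambda:E\to\mathbb{N}$ assigns each edge a single label such that any two distinct edges sharing an endpoint have distinct labels. A journey is a sequence of edges $\{u_1,u_2\},\dots,\{u_k,u_{k+1}\}$ ($k\ge1$) with the $u_i$ pairwise distinct and strictly increasing labels. For a vertex $v$, $e^-(v)$ denotes the edge incident to $v$ with the smallest label. Let $E^-$ be the set of arcs on $V$ containing, for each vertex $v$ with $e^-(v)=\{u,v\}$, the arc $(u,v)$, except that whenever $e^-(u)=e^-(v)$ only one of $(u,v),(v,u)$ is included (chosen arbitrarily). A sink of $E^-$ is a vertex of out-degree $0$ in $(V,E^-)$. $E^-_T$ is obtained from $E^-$ as follows: for every vertex $v$ of out-degree at least $2$ in $E^-$, let $(v,u_1),\dots,(v,u_\ell)$ be its out-arcs where $(v,u_\ell)$ has the largest label; for each $i<\ell$, if $u_i$ is a sink of $E^-$ replace $(v,u_i)$ by $(u_i,v)$, otherwise delete $(v,u_i)$. The emitters are the vertices of out-degree $0$ in $(V,E^-_T)$; the weakly connected components of $(V,E^-_T)$ are called in-trees. -}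

module Defs where

open import Data.Nat using (ℕ; _<_; _≤_)
open import Data.Fin using (Fin)
open import Data.Product using (_×_; Σ; ∃; _,_)
open import Data.Sum using (_⊎_)
open import Data.Empty using (⊥)
open import Relation.Nullary using (¬_)
open import Relation.Binary.PropositionalEquality using (_≡_; _≢_)
open import Relation.Binary.Construct.Closure.ReflexiveTransitive using (Star)
open import Relation.Binary.Construct.Closure.Symmetric using (SymClosure)

-- Vertex set V = Fin n; the labelling λ of the complete graph is given as a
-- function lab : Fin n → Fin n → ℕ, of which only the values on distinct pairs
-- matter; it must be symmetric (λ is a function of the unordered edge).
Symmetric : {n : ℕ} → (Fin n → Fin n → ℕ) → Set
Symmetric {n} lab = ∀ (u v : Fin n) → u ≢ v → lab u v ≡ lab v u

Proper : {n : ℕ} → (Fin n → Fin n → ℕ) → Set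
Proper {n} lab = ∀ (u v w : Fin n) → u ≢ v → u ≢ w → v ≢ w → lab u v ≢ lab u w

module _ {n : ℕ} (lab : Fin n → Fin n → ℕ) where

  -- MinNbr v u : e⁻(v) = {v,u}, i.e. {v,u} is the edge at v with smallest label
  MinNbr : Fin n → Fin n → Set
  MinNbr v u = u ≢ v × (∀ w → w ≢ v → w ≢ u → lab v u < lab v w)

  -- Em is a valid choice of the arc set E⁻ :
  --  * every arc (u,v) of E⁻ satisfies e⁻(v) = {u,v};
  --  * if e⁻(v) = {u,v} and e⁻(u) ≠ {u,v} then (u,v) ∈ E⁻;
  --  * if e⁻(v) = e⁻(u) = {u,v} then exactly one of (u,v), (v,u) is in E⁻.
  IsEMinus : (Fin n → Fin n → Set) → Set
  IsEMinus Em =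
      (∀ u v → Em u v → MinNbr v u)
    × (∀ u v → MinNbr v u → ¬ MinNbr u v → Em u v)
    × (∀ u v → MinNbr v u → MinNbr u v → (Em u v ⊎ Em v u) × ¬ (Em u v × Em v u))

  module _ (Em : Fin n → Fin n → Set) where

    Sink : Fin n → Set
    Sink v = ∀ w → ¬ Em v w

    -- arcs of E⁻_T :
    --  * an arc (x,y) of E⁻ is kept iff it is the out-arc of x with the largest label
    --    (in particular every arc from a vertex of out-degree 1 is kept);
    --  * a non-largest out-arc (y,x) of E⁻ with x a sink of E⁻ is replaced by (x,y);
    --  * all other non-largest out-arcs are deleted.
    data ET : Fin n → Fin n → Set where
      keep : ∀ {x y} → Em x y → (∀ z → Em x z → z ≢ y → lab x z < lab x y) → ET x y
      flip : ∀ {x y z} → Em y x → Em y z → lab y x < lab y z → Sink x → ET x y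

    Emitter : Fin n → Set
    Emitter v = ∀ w → ¬ ET v w

    SameComponent : Fin n → Fin n → Set
    SameComponent = Star (SymClosure ET)

  ShortJourneyToMin : Fin n → Fin n → Set
  ShortJourneyToMin v v' =
      (v ≢ v' × MinNbr v' v)
    ⊎ Σ (Fin n) (λ w → v ≢ w × w ≢ v' × v ≢ v' × lab v w < lab w v' × MinNbr v' w)

-- If v has an out-arc in E⁻, its out-arc (v,m) of largest label survives in E⁻_T, and
-- e⁻(m) = {v,m} is a one-edge journey. Otherwise v is a sink of E⁻, so, not being an
-- emitter, it received a flipped arc (v,y) from a non-largest out-arc (y,v) of E⁻.
-- The largest out-arc (y,m) of y is kept, so v, y, m lie in one in-tree, and since
-- λ(y,v) < λ(y,m) = λ(e⁻(m)) the edges {v,y}, {y,m} form a two-edge journey.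
module Submission where

open import Defs
open import Data.Nat using (ℕ; zero; suc; _≤_; _<_)
open import Data.Nat.Properties using (≤-refl; ≤-trans; <⇒≤; ≰⇒>; _≤?_; _<?_; <-≤-trans; <-irrefl; ≤∧≢⇒<)
open import Data.Fin using (Fin; zero; suc)
open import Data.Fin.Properties using (any?; all?) renaming (_≟_ to _≟ᶠ_)
open import Data.Product using (_×_; Σ; ∃; _,_; proj₁; proj₂)
open import Data.Sum using (_⊎_; inj₁; inj₂)
open import Data.Empty using (⊥-elim)
open import Relation.Nullary using (¬_; Dec; yes; no)
open import Relation.Nullary.Decidable using (_×-dec_; _→-dec_; ¬?)
open import Relation.Unary using (Pred; Decidable)
open import Relation.Binary.PropositionalEquality using (_≢_; refl; sym; subst)
open import Relation.Binary.Construct.Closure.ReflexiveTransitive using (ε; _◅_)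
open import Relation.Binary.Construct.Closure.Symmetric using (fwd)

argmax : ∀ {n ℓ} {P : Pred (Fin n) ℓ} → Decidable P → (f : Fin n → ℕ) →
         (∀ z → ¬ P z) ⊎ ∃ λ m → P m × (∀ z → P z → f z ≤ f m)
argmax {zero}  P? f = inj₁ λ ()
argmax {suc n} P? f with argmax (λ i → P? (suc i)) (λ i → f (suc i)) | P? zero
... | inj₁ none          | no ¬p₀ = inj₁ λ { zero p → ¬p₀ p ; (suc i) p → none i p }
... | inj₁ none          | yes p₀ = inj₂ (zero , p₀ , λ { zero _ → ≤-refl ; (suc i) p → ⊥-elim (none i p) })
... | inj₂ (m , pm , ≤m) | no ¬p₀ = inj₂ (suc m , pm , λ { zero p → ⊥-elim (¬p₀ p) ; (suc i) p → ≤m i p })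
... | inj₂ (m , pm , ≤m) | yes p₀ with f zero ≤? f (suc m)
...   | yes f₀≤ = inj₂ (suc m , pm , λ { zero _ → f₀≤ ; (suc i) p → ≤m i p })
...   | no  f₀≰ = inj₂ (zero , p₀ , λ { zero _ → ≤-refl ; (suc i) p → ≤-trans (≤m i p) (<⇒≤ (≰⇒> f₀≰)) })

minNbr? : ∀ {n} (lab : Fin n → Fin n → ℕ) (v u : Fin n) → Dec (MinNbr lab v u)
minNbr? lab v u =
  ¬? (u ≟ᶠ v) ×-dec all? λ w → ¬? (w ≟ᶠ v) →-dec (¬? (w ≟ᶠ u) →-dec (lab v u <? lab v w))

module _ {n : ℕ} {lab : Fin n → Fin n → ℕ} (proper : Proper lab)
         {Em : Fin n → Fin n → Set} (isEMinus : IsEMinus lab Em) where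

  private
    Em⇒MinNbr : ∀ {u v} → Em u v → MinNbr lab v u
    Em⇒MinNbr {u} {v} = proj₁ isEMinus u v

    oneWay⇒Em : ∀ u v → MinNbr lab v u → ¬ MinNbr lab u v → Em u v
    oneWay⇒Em = proj₁ (proj₂ isEMinus)

    mutual⇒exactlyOne : ∀ u v → MinNbr lab v u → MinNbr lab u v →
                        (Em u v ⊎ Em v u) × ¬ (Em u v × Em v u)
    mutual⇒exactlyOne = proj₂ (proj₂ isEMinus)

    Em-irrefl : ∀ {u v} → Em u v → u ≢ v
    Em-irrefl e = proj₁ (Em⇒MinNbr e)

  Em? : ∀ u v → Dec (Em u v)
  Em? u v with minNbr? lab v u
  ... | no ¬min = no λ e → ¬min (Em⇒MinNbr e)
  ... | yes min with minNbr? lab u v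
  ...   | no ¬min′ = yes (oneWay⇒Em u v min ¬min′)
  ...   | yes min′ with mutual⇒exactlyOne u v min min′
  ...     | inj₁ e , _         = yes e
  ...     | inj₂ e , not-both = no λ e′ → not-both (e′ , e)

  LargestOutArc : Fin n → Fin n → Set
  LargestOutArc x m = Em x m × (∀ z → Em x z → lab x z ≤ lab x m)

  largestOutArc? : ∀ x → Sink lab Em x ⊎ ∃ (LargestOutArc x)
  largestOutArc? x = argmax (Em? x) (lab x)

  largestOutArc⇒ET : ∀ {x m} → LargestOutArc x m → ET lab Em x m
  largestOutArc⇒ET (e , ≤m) =
    keep e λ z ez z≢m → ≤∧≢⇒< (≤m z ez) (proper _ z _ (Em-irrefl ez) (Em-irrefl e) z≢m)

  FlippedInto : Fin n → Set
  FlippedInto v = ∃ λ y → Em y v × ∃ λ z → Em y z × lab y v < lab y z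

  flippedInto? : ∀ v → Dec (FlippedInto v)
  flippedInto? v = any? λ y → Em? y v ×-dec any? λ z → Em? y z ×-dec (lab y v <? lab y z)

  sink-nonEmitter⇒FlippedInto : ∀ {v} → Sink lab Em v → ¬ Emitter lab Em v → FlippedInto v
  sink-nonEmitter⇒FlippedInto {v} sink nonEmitter with flippedInto? v
  ... | yes flipped = flipped
  ... | no ¬flipped = ⊥-elim (nonEmitter λ
          { w (keep e _)                  → sink w e
          ; w (flip {z = z} e₁ e₂ lt _) → ¬flipped (w , e₁ , z , e₂ , lt) })

  ShortJourneyInComponent : Fin n → Fin n → Set
  ShortJourneyInComponent v v′ = v′ ≢ v × SameComponent lab Em v v′ × ShortJourneyToMin lab v v′

  largestOutArc⇒journey : ∀ {v m} → LargestOutArc v m → ShortJourneyInComponent v m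
  largestOutArc⇒journey {v} {m} arc@(e , _) =
    (λ m≡v → v≢m (sym m≡v)) , fwd (largestOutArc⇒ET arc) ◅ ε , inj₁ (v≢m , Em⇒MinNbr e)
    where
    v≢m : v ≢ m
    v≢m = Em-irrefl e

  flipped-sink⇒journey : Symmetric lab → ∀ {v} → Sink lab Em v → FlippedInto v →
                         ∃ (ShortJourneyInComponent v)
  flipped-sink⇒journey symmetric {v} sink (y , eyv , z , eyz , v<z) with largestOutArc? y
  ... | inj₁ y-sink = ⊥-elim (y-sink z eyz)
  ... | inj₂ (m , arc@(eym , ≤m)) =
    m , m≢v , fwd (flip eyv eyz v<z sink) ◅ fwd (largestOutArc⇒ET arc) ◅ ε ,
    inj₂ (y , v≢y , Em-irrefl eym , (λ v≡m → m≢v (sym v≡m)) ,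
          subst (_< lab y m) (symmetric y v (λ y≡v → v≢y (sym y≡v))) v<m , Em⇒MinNbr eym)
    where
    v<m : lab y v < lab y m
    v<m = <-≤-trans v<z (≤m z eyz)

    m≢v : m ≢ v
    m≢v refl = <-irrefl refl v<m

    v≢y : v ≢ y
    v≢y v≡y = Em-irrefl eyv (sym v≡y)

lemma4 : (n : ℕ) → 2 ≤ n → (lab : Fin n → Fin n → ℕ) → Symmetric lab → Proper lab →
    (Em : Fin n → Fin n → Set) → IsEMinus lab Em →
    (v : Fin n) → ¬ Emitter lab Em v →
    Σ (Fin n) (λ v' → v' ≢ v × SameComponent lab Em v v' × ShortJourneyToMin lab v v')
lemma4 n _ lab symmetric proper Em isEMinus v nonEmitter with largestOutArc? proper isEMinus v
... | inj₂ (m , arc) = m , largestOutArc⇒journey proper isEMinus arc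
... | inj₁ sink      = flipped-sink⇒journey proper isEMinus symmetric sink
                         (sink-nonEmitter⇒FlippedInto proper isEMinus sink nonEmitter)
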